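{- Let $\mathcal{A}=\langle Q,\Sigma,\delta,q_{init},col\rangle$ be a deterministic parity automaton over $\Sigma=\{0,1\}^3$, with $Q=\{q_1,\dots,q_{|Q|}\}$. (1) There is an MLO formula $\mathit{WinSt}^I_{\mathcal{A}}(Z_1,\dots,Z_{|Q|},Z)$ such that for every $\mathbf{P}\subseteq\mathbb{N}$ and $W_1,\dots,W_{|Q|}\subseteq\mathbb{N}$: $\langle\mathbb{N},<\rangle\models\mathit{WinSt}^I_{\mathcal{A}}(W_1,\dots,W_{|Q|},\mathbf{P})$ iff the set $U=\{\langle q_k,m\rangle: m\in W_k\}\subseteq Q\times\mathbb{N}$ defines a memoryless winning strategy for Player I in $G_{\mathcal{A},\mathbf{P}}$. (2) There is an MLO formula $\mathit{WinSt}^{II}_{\mathcal{A}}(Z_1,\dots,Z_{|Q|},Z'_1,\dots,Z'_{|Q|},Z)$ such that for every $\mathbf{P}\subseteq\mathbb{N}$ and $W_1,\dots,W_{|Q|},W'_1,\dots,W'_{|Q|}\subseteq\mathbb{N}$: $\langle\mathbb{N},<\rangle\models\mathit{WinSt}^{II}_{\mathcal{A}}(W_1,\dots,W_{|Q|},W'_1,\dots,W'_{|Q|},\mathbf{P})$ iff the set $U=\{\langle q_k,0,m\rangle:m\in W_k\}\cup\{\langle q_k,1,m\rangle:m\in W'_k\}\subseteq Q\times\{0,1\}\times\mathbb{N}$ defines a memoryless winning strategy for Player II in $G_{\mathcal{A},\mathbf{P}}$. (3) Moreover, there is an algorithm computing $\mathit{WinSt}^I_{\mathcal{A}}$ and $\mathit{WinSt}^{II}_{\mathcal{A}}$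 from $\mathcal{A}$.
   Context: A deterministic parity automaton has finite state set $Q$, transition $\delta:Q\times\Sigma\to Q$, initial state $q_{init}$, colouring $col:Q\to\mathbb{N}$. MLO is monadic second-order logic over $<$ on $\mathbb{N}$. Game $G_{\mathcal{A},\mathbf{P}}$ ($\mathbf{P}\subseteq\mathbb{N}$): $V_1=Q\times\mathbb{N}$ (Player I), $V_2=Q\times\{0,1\}\times\mathbb{N}$ (Player II). From $\langle q,n\rangle$ an edge labelled $0$ goes to $\langle q,0,n\rangle$ and one labelled $1$ to $\langle q,1,n\rangle$. From $\langle q,a,n\rangle$, with $c=1$ if $n\in\mathbf{P}$ and $c=0$ otherwise, an edge labelled $b$ goes to $\langle\delta(q,\langle a,b,c\rangle),n+1\rangle$ ($b\in\{0,1\}$). Node $\langle q,n\rangle$ or $\langle q,a,n\rangle$ has colour $col(q)$. Plays start at $\langle q_{init},0\rangle$, the owner of the current node choosing the next edge; Player I wins a play iff the minimal colour occurring infinitely often is odd, otherwise Player II wins. For $U\subseteq V_1$ (resp. $V_2$) the memoryless strategy defined by $U$ takes, at each node $v$ of its owner, the edge labelled $1$ iff $v\in U$; it is winning if every play consistent with it is won by its owner. -}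

module Defs where

open import Data.Nat using (ℕ; zero; suc; _+_; _≤_; _<_; _%_)
open import Data.Fin using (Fin)
open import Data.Bool using (Bool; true; false)
open import Data.Product using (Σ; ∃; _×_; _,_)
open import Data.Sum using (_⊎_; inj₁; inj₂)
open import Data.Unit using (⊤)
open import Data.Empty using (⊥)
open import Relation.Nullary using (¬_)
open import Relation.Binary.PropositionalEquality using (_≡_)
open import Data.Vec.Functional using (Vector; _∷_; _++_)

-- Deterministic parity automata over Σ = {0,1}^3, with Q = Fin n
-- (0 is encoded as false, 1 as true).

Letter : Set
Letter = Bool × Bool × Bool

record DPA (n : ℕ) : Set where
  field
    δ     : Fin n → Letter → Fin n
    qinit : Fin n
    col   : Fin n → ℕ

SubsetN : Set
SubsetN = ℕ → Bool

-- MLO: monadic second-order logic over ⟨ℕ,<⟩.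
-- Formula m k : at most m free first-order and k free second-order
-- variables (de Bruijn indices).

data Formula (m k : ℕ) : Set where
  _<ᶠ_ : Fin m → Fin m → Formula m k
  _≐ᶠ_ : Fin m → Fin m → Formula m k
  _∈ᶠ_ : Fin m → Fin k → Formula m k
  ⊤ᶠ ⊥ᶠ : Formula m k
  ¬ᶠ_   : Formula m k → Formula m k
  _∧ᶠ_ _∨ᶠ_ _⇒ᶠ_ : Formula m k → Formula m k → Formula m k
  ∃¹ ∀¹ : Formula (suc m) k → Formula m k
  ∃² ∀² : Formula m (suc k) → Formula m k

Sat : ∀ {m k} → Formula m k → Vector ℕ m → Vector SubsetN k → Set
Sat (x <ᶠ y) ρ σ = ρ x < ρ y
Sat (x ≐ᶠ y) ρ σ = ρ x ≡ ρ y
Sat (x ∈ᶠ X) ρ σ = σ X (ρ x) ≡ true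
Sat ⊤ᶠ ρ σ = ⊤
Sat ⊥ᶠ ρ σ = ⊥
Sat (¬ᶠ φ) ρ σ = ¬ Sat φ ρ σ
Sat (φ ∧ᶠ ψ) ρ σ = Sat φ ρ σ × Sat ψ ρ σ
Sat (φ ∨ᶠ ψ) ρ σ = Sat φ ρ σ ⊎ Sat ψ ρ σ
Sat (φ ⇒ᶠ ψ) ρ σ = Sat φ ρ σ → Sat ψ ρ σ
Sat (∃¹ φ) ρ σ = Σ ℕ λ a → Sat φ (a ∷ ρ) σ
Sat (∀¹ φ) ρ σ = (a : ℕ) → Sat φ (a ∷ ρ) σ
Sat (∃² φ) ρ σ = Σ SubsetN λ S → Sat φ ρ (S ∷ σ)
Sat (∀² φ) ρ σ = (S : SubsetN) → Sat φ ρ (S ∷ σ)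

_⊨_ : ∀ {k} → Vector SubsetN k → Formula 0 k → Set
σ ⊨ φ = Sat φ (λ ()) σ

module _ {n : ℕ} (A : DPA n) (P : SubsetN) where
  open DPA A

  V₁ V₂ Vtx : Set
  V₁ = Fin n × ℕ
  V₂ = Fin n × Bool × ℕ
  Vtx = V₁ ⊎ V₂

  colV : Vtx → ℕ
  colV (inj₁ (q , _)) = col q
  colV (inj₂ (q , _ , _)) = col q

  step : Vtx → Bool → Vtx
  step (inj₁ (q , m)) a = inj₂ (q , a , m)
  step (inj₂ (q , a , m)) b = inj₁ (δ q (a , b , P m) , suc m)

  IsPlay : (ℕ → Vtx) → Set
  IsPlay π = (π 0 ≡ inj₁ (qinit , 0)) × (∀ i → ∃ λ l → π (suc i) ≡ step (π i) l)

  ConsistentI : (V₁ → Bool) → (ℕ → Vtx) → Set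
  ConsistentI U π = ∀ i (v : V₁) → π i ≡ inj₁ v → π (suc i) ≡ step (inj₁ v) (U v)

  ConsistentII : (V₂ → Bool) → (ℕ → Vtx) → Set
  ConsistentII U π = ∀ i (v : V₂) → π i ≡ inj₂ v → π (suc i) ≡ step (inj₂ v) (U v)

  InfOften : (ℕ → Vtx) → ℕ → Set
  InfOften π c = ∀ N → ∃ λ m → N ≤ m × colV (π m) ≡ c

  Odd : ℕ → Set
  Odd c = c % 2 ≡ 1

  WinsI : (ℕ → Vtx) → Set
  WinsI π = ∃ λ c → InfOften π c × (∀ c' → c' < c → ¬ InfOften π c') × Odd c

  WinsII : (ℕ → Vtx) → Set
  WinsII π = ¬ WinsI π

  WinningStratI : (V₁ → Bool) → Set
  WinningStratI U = ∀ π → IsPlay π → ConsistentI U π → WinsI π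

  WinningStratII : (V₂ → Bool) → Set
  WinningStratII U = ∀ π → IsPlay π → ConsistentII U π → WinsII π

UI : ∀ {n} → Vector SubsetN n → Fin n × ℕ → Bool
UI W (q , m) = W q m

UII : ∀ {n} → Vector SubsetN n → Vector SubsetN n → Fin n × Bool × ℕ → Bool
UII W W' (q , false , m) = W q m
UII W W' (q , true , m) = W' q m

-- A play is determined by two bit sequences α, β ⊆ ℕ, the choices of Players I and II in each
-- round; the vertex of round m then carries the state reached by A on the word
-- (α i , β i , P i)_{i<m}, and the plays consistent with U are exactly those whose owner's bits
-- follow U along this run.  MLO cannot speak about plays, but it can speak about the run: sets
-- S_q are its graph iff 0 ∈ S_{q_init}, the S_q are closed under δ and pairwise disjoint, and
-- the parity condition on the run is a finite Boolean combination of "a state of colour c occurs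
-- infinitely often".  So U is winning iff for all α, β and all S_q forming the graph of the run,
-- if the owner's bits follow U then the run is accepting (Player I) or rejecting (Player II).

module Submission where

open import Defs
open import Data.Nat using (ℕ; zero; suc; _+_; _≤_; _<_; _%_; z≤n; s≤s; _<?_)
open import Data.Nat.Properties
  using (≤-refl; ≤-trans; ≤-pred; <⇒≱; ≤⇒≯; ≮⇒≥; m≤n⇒m<n∨m≡n; n≤1+n; m≤m+n; +-suc; +-mono-≤; 1+n≰n)
  renaming (_≟_ to _≟ℕ_)
open import Data.Fin using (Fin; zero; suc; _↑ˡ_; _↑ʳ_)
open import Data.Fin.Properties using (_≟_; ∀-cons-⇔; ⊎⇔∃)
open import Data.Bool using (Bool; true; false)
open import Data.Bool.Properties using (⇔→≡; ¬-not)
open import Data.Product using (Σ; ∃; _×_; _,_; proj₁; proj₂)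
open import Data.Product.Function.NonDependent.Propositional using (_×-⇔_)
open import Data.Sum using (inj₁; inj₂; [_,_])
open import Data.Sum.Function.Propositional using (_⊎-⇔_)
open import Data.Unit using (tt)
open import Data.Empty using (⊥-elim)
open import Relation.Nullary using (¬_; Dec; yes; no; does)
open import Relation.Binary.PropositionalEquality hiding ([_])
open import Data.Vec.Functional using (Vector; []; _∷_; _++_)
open import Data.Vec.Functional.Properties using (lookup-++ˡ; lookup-++ʳ)
open import Function using (_∘_; const)
open import Function.Bundles using (_⇔_; mk⇔; Equivalence)
open import Function.Related.TypeIsomorphisms using (→-cong-⇔; ¬-cong-⇔)
import Function.Properties.Equivalence as ⇔

open Equivalence using (to; from)

∀-cong-⇔ : ∀ {X : Set} {B C : X → Set} → (∀ x → B x ⇔ C x) → (∀ x → B x) ⇔ (∀ x → C x)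
∀-cong-⇔ e = mk⇔ (λ h x → to (e x) (h x)) (λ h x → from (e x) (h x))

∃-cong-⇔ : ∀ {X : Set} {B C : X → Set} → (∀ x → B x ⇔ C x) → ∃ B ⇔ ∃ C
∃-cong-⇔ e = mk⇔ (λ (x , b) → x , to (e x) b) (λ (x , c) → x , from (e x) c)

∀-≡-⇔ : ∀ {X : Set} {B : X → Set} {x : X} → (∀ y → y ≡ x → B y) ⇔ B x
∀-≡-⇔ = mk⇔ (λ h → h _ refl) (λ { b _ refl → b })

decᶠ : ∀ {m k} {X : Set} → Dec X → Formula m k
decᶠ (yes _) = ⊤ᶠ
decᶠ (no _) = ⊥ᶠ

decᶠ-sem : ∀ {m k} {X : Set} (d : Dec X) {ρ : Vector ℕ m} {σ : Vector SubsetN k} →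
           Sat (decᶠ d) ρ σ ⇔ X
decᶠ-sem (yes x) = mk⇔ (λ _ → x) (λ _ → tt)
decᶠ-sem (no ¬x) = mk⇔ (λ ()) ¬x

litᶠ : ∀ {m k} → Fin m → Fin k → Bool → Formula m k
litᶠ x X true = x ∈ᶠ X
litᶠ x X false = ¬ᶠ (x ∈ᶠ X)

litᶠ-sem : ∀ {m k} (x : Fin m) (X : Fin k) b {ρ : Vector ℕ m} {σ : Vector SubsetN k} →
           Sat (litᶠ x X b) ρ σ ⇔ (b ≡ σ X (ρ x))
litᶠ-sem x X true = mk⇔ sym sym
litᶠ-sem x X false = mk⇔ (λ ∉ → sym (¬-not ∉)) (λ e ∈ → false≢true (trans e ∈))
  where
  false≢true : false ≢ true
  false≢true ()

_⇔ᶠ_ : ∀ {m k} → Formula m k → Formula m k → Formula m k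
φ ⇔ᶠ ψ = (φ ⇒ᶠ ψ) ∧ᶠ (ψ ⇒ᶠ φ)

∈ᶠ-⇔ᶠ-sem : ∀ {m k} (x : Fin m) (X Y : Fin k) {ρ : Vector ℕ m} {σ : Vector SubsetN k} →
            Sat ((x ∈ᶠ X) ⇔ᶠ (x ∈ᶠ Y)) ρ σ ⇔ (σ X (ρ x) ≡ σ Y (ρ x))
∈ᶠ-⇔ᶠ-sem x X Y = mk⇔ (λ (f , g) → ⇔→≡ (mk⇔ f g)) (λ e → trans (sym e) , trans e)

⋀ : ∀ {j m k} → (Fin j → Formula m k) → Formula m k
⋀ {zero} f = ⊤ᶠ
⋀ {suc j} f = f zero ∧ᶠ ⋀ (f ∘ suc)

⋀-sem : ∀ {j m k} (f : Fin j → Formula m k) {ρ : Vector ℕ m} {σ : Vector SubsetN k} →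
        Sat (⋀ f) ρ σ ⇔ (∀ i → Sat (f i) ρ σ)
⋀-sem {zero} f = mk⇔ (λ _ ()) (λ _ → tt)
⋀-sem {suc j} f = ⇔.trans (⇔.refl ×-⇔ ⋀-sem (f ∘ suc)) ∀-cons-⇔

⋁ : ∀ {j m k} → (Fin j → Formula m k) → Formula m k
⋁ {zero} f = ⊥ᶠ
⋁ {suc j} f = f zero ∨ᶠ ⋁ (f ∘ suc)

⋁-sem : ∀ {j m k} (f : Fin j → Formula m k) {ρ : Vector ℕ m} {σ : Vector SubsetN k} →
        Sat (⋁ f) ρ σ ⇔ (∃ λ i → Sat (f i) ρ σ)
⋁-sem {zero} f = mk⇔ (λ ()) (λ ())
⋁-sem {suc j} f = ⇔.trans (⇔.refl ⊎-⇔ ⋁-sem (f ∘ suc)) ⊎⇔∃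

⋀ᴮ : ∀ {m k} → (Bool → Formula m k) → Formula m k
⋀ᴮ f = f false ∧ᶠ f true

⋀ᴮ-sem : ∀ {m k} (f : Bool → Formula m k) {ρ : Vector ℕ m} {σ : Vector SubsetN k} →
         Sat (⋀ᴮ f) ρ σ ⇔ (∀ b → Sat (f b) ρ σ)
⋀ᴮ-sem f = mk⇔ (λ { (h , _) false → h ; (_ , h) true → h }) (λ h → h false , h true)

⋀ᴸ : ∀ {m k} → (Letter → Formula m k) → Formula m k
⋀ᴸ f = ⋀ᴮ λ a → ⋀ᴮ λ b → ⋀ᴮ λ c → f (a , b , c)

⋀ᴸ-sem : ∀ {m k} (f : Letter → Formula m k) {ρ : Vector ℕ m} {σ : Vector SubsetN k} →
         Sat (⋀ᴸ f) ρ σ ⇔ (∀ l → Sat (f l) ρ σ)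
⋀ᴸ-sem f = mk⇔
  (λ h (a , b , c) → to (⋀ᴮ-sem (f₂ a b)) (to (⋀ᴮ-sem (f₁ a)) (to (⋀ᴮ-sem f₀) h a) b) c)
  (λ h → from (⋀ᴮ-sem f₀) λ a → from (⋀ᴮ-sem (f₁ a)) λ b → from (⋀ᴮ-sem (f₂ a b)) λ c →
    h (a , b , c))
  where
  f₂ : Bool → Bool → Bool → Formula _ _
  f₂ a b c = f (a , b , c)
  f₁ : Bool → Bool → Formula _ _
  f₁ a b = ⋀ᴮ (f₂ a b)
  f₀ : Bool → Formula _ _
  f₀ a = ⋀ᴮ (f₁ a)

prepend : (j : ℕ) → ∀ {k} → Vector SubsetN j → Vector SubsetN k → Vector SubsetN (j + k)
prepend zero T σ = σ
prepend (suc j) T σ = T zero ∷ prepend j (T ∘ suc) σ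

prepend-↑ˡ : ∀ j {k} (T : Vector SubsetN j) (σ : Vector SubsetN k) q → prepend j T σ (q ↑ˡ k) ≡ T q
prepend-↑ˡ (suc j) T σ zero = refl
prepend-↑ˡ (suc j) T σ (suc q) = prepend-↑ˡ j (T ∘ suc) σ q

prepend-↑ʳ : ∀ j {k} (T : Vector SubsetN j) (σ : Vector SubsetN k) i → prepend j T σ (j ↑ʳ i) ≡ σ i
prepend-↑ʳ zero T σ i = refl
prepend-↑ʳ (suc j) T σ i = prepend-↑ʳ j (T ∘ suc) σ i

∀²ⁿ : (j : ℕ) → ∀ {m k} → Formula m (j + k) → Formula m k
∀²ⁿ zero φ = φ
∀²ⁿ (suc j) φ = ∀²ⁿ j (∀² φ)

∀²ⁿ-sem : (j : ℕ) → ∀ {m k} (φ : Formula m (j + k)) {ρ : Vector ℕ m} {σ : Vector SubsetN k} →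
          Sat (∀²ⁿ j φ) ρ σ ⇔ (∀ T → Sat φ ρ (prepend j T σ))
∀²ⁿ-sem zero φ = mk⇔ (λ h _ → h) (λ h → h (λ ()))
∀²ⁿ-sem (suc j) φ = ⇔.trans (∀²ⁿ-sem j (∀² φ))
  (mk⇔ (λ h T → h (T ∘ suc) (T zero)) (λ h T S → h (S ∷ T)))

run : ∀ {n} → DPA n → (ℕ → Letter) → ℕ → Fin n
run A w zero = DPA.qinit A
run A w (suc m) = DPA.δ A (run A w m) (w m)

run-cong : ∀ {n} (A : DPA n) {w w' : ℕ → Letter} → w ≗ w' → run A w ≗ run A w'
run-cong A e zero = refl
run-cong A e (suc m) = cong₂ (DPA.δ A) (run-cong A e m) (e m)

Graph : ∀ {n} → (ℕ → Fin n) → (Fin n → SubsetN) → Set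
Graph r S = ∀ q m → S q m ≡ true ⇔ r m ≡ q

graph : ∀ {n} → (ℕ → Fin n) → Fin n → SubsetN
graph r q m = does (r m ≟ q)

Graph-graph : ∀ {n} (r : ℕ → Fin n) {S : Fin n → SubsetN} →
              (∀ q m → S q m ≡ graph r q m) → Graph r S
Graph-graph r e q m rewrite e q m with r m ≟ q
... | yes r≡q = mk⇔ (λ _ → r≡q) (λ _ → refl)
... | no r≢q = mk⇔ (λ ()) (⊥-elim ∘ r≢q)

Graph-cong : ∀ {n} {r r' : ℕ → Fin n} (S : Fin n → SubsetN) → r ≗ r' → Graph r S ⇔ Graph r' S
Graph-cong S e = mk⇔ (λ g q m → ⇔.trans (g q m) (mk⇔ (trans (sym (e m))) (trans (e m))))
                     (λ g q m → ⇔.trans (g q m) (mk⇔ (trans (e m)) (trans (sym (e m)))))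

∀-graph-⇔ : ∀ {n} {r : ℕ → Fin n} {S : Fin n → SubsetN} {B : Fin n → Set} → Graph r S →
            ∀ m → (∀ q → S q m ≡ true → B q) ⇔ B (r m)
∀-graph-⇔ {r = r} g m = mk⇔ (λ h → h (r m) (from (g (r m) m) refl))
                             (λ b q s → subst _ (to (g q m) s) b)

∃-graph-⇔ : ∀ {n} {r : ℕ → Fin n} {S : Fin n → SubsetN} {B : Fin n → Set} → Graph r S →
            ∀ m → (∃ λ q → B q × S q m ≡ true) ⇔ B (r m)
∃-graph-⇔ {r = r} g m = mk⇔ (λ (q , b , s) → subst _ (sym (to (g q m) s)) b)
                             (λ b → r m , b , from (g (r m) m) refl)

module _ {n} (A : DPA n) (w : ℕ → Letter) (S : Fin n → SubsetN) where
  open DPA A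

  Graph-run⇔ : Graph (run A w) S ⇔
               (S qinit 0 ≡ true
                × (∀ m q → S q m ≡ true → S (δ q (w m)) (suc m) ≡ true)
                × (∀ m q q' → S q m ≡ true × S q' m ≡ true → q ≡ q'))
  Graph-run⇔ = mk⇔
    (λ g → from (g qinit 0) refl
         , (λ m q s → from (g _ (suc m)) (cong (λ p → δ p (w m)) (to (g q m) s)))
         , (λ m q q' (s , s') → trans (sym (to (g q m) s)) (to (g q' m) s')))
    (λ (init , closed , functional) q m →
      mk⇔ (λ s → functional m (run A w m) q (onRun init closed m , s))
          (λ { refl → onRun init closed m }))
    where
    onRun : S qinit 0 ≡ true → (∀ m q → S q m ≡ true → S (δ q (w m)) (suc m) ≡ true) →
            ∀ m → S (run A w m) m ≡ true
    onRun init closed zero = init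
    onRun init closed (suc m) = closed m (run A w m) (onRun init closed m)

Recurrent : (ℕ → ℕ) → ℕ → Set
Recurrent χ c = ∀ N → ∃ λ m → N ≤ m × χ m ≡ c

-- WinsI A P π unfolds to MinRecurrentOdd (colV A P ∘ π).
MinRecurrentOdd : (ℕ → ℕ) → Set
MinRecurrentOdd χ = ∃ λ c → Recurrent χ c × (∀ c' → c' < c → ¬ Recurrent χ c') × c % 2 ≡ 1

recurrent-≗ : ∀ {χ χ' : ℕ → ℕ} → χ ≗ χ' → ∀ c → Recurrent χ c ⇔ Recurrent χ' c
recurrent-≗ e c = mk⇔ (transport e) (transport (sym ∘ e))
  where
  transport : ∀ {χ χ'} → χ ≗ χ' → Recurrent χ c → Recurrent χ' c
  transport e rec N with rec N
  ... | m , le , χm≡c = m , le , trans (sym (e m)) χm≡c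

minRecurrentOdd-cong : ∀ {χ χ' : ℕ → ℕ} → (∀ c → Recurrent χ c ⇔ Recurrent χ' c) →
                       MinRecurrentOdd χ ⇔ MinRecurrentOdd χ'
minRecurrentOdd-cong e = mk⇔
  (λ (c , rec , min , odd) → c , to (e c) rec , (λ c' lt → min c' lt ∘ from (e c')) , odd)
  (λ (c , rec , min , odd) → c , from (e c) rec , (λ c' lt → min c' lt ∘ to (e c')) , odd)

module _ {X : Set} (col : X → ℕ) (r : ℕ → X) where

  recurrent-colour : ∀ {c} → Recurrent (col ∘ r) c → ∃ λ x → col x ≡ c
  recurrent-colour rec with rec 0
  ... | m , _ , e = r m , e

  OddMinimalPoint : Set
  OddMinimalPoint = ∃ λ x → col x % 2 ≡ 1 × Recurrent (col ∘ r) (col x)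
                              × (∀ x' → col x' < col x → ¬ Recurrent (col ∘ r) (col x'))

  -- turns the parity condition into a finite disjunction over the points
  minRecurrentOdd⇔ : MinRecurrentOdd (col ∘ r) ⇔ OddMinimalPoint
  minRecurrentOdd⇔ = mk⇔ toPoint fromPoint
    where
    toPoint : MinRecurrentOdd (col ∘ r) → OddMinimalPoint
    toPoint (c , rec , min , odd) with recurrent-colour rec
    ... | x , refl = x , odd , rec , λ x' lt → min (col x') lt
    fromPoint : OddMinimalPoint → MinRecurrentOdd (col ∘ r)
    fromPoint (x , odd , rec , min) = col x , rec , below , odd
      where
      below : ∀ c' → c' < col x → ¬ Recurrent (col ∘ r) c'
      below c' lt rec' with recurrent-colour rec'
      ... | x' , refl = min x' lt rec'

word : SubsetN → SubsetN → SubsetN → ℕ → Letter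
word P α β m = α m , β m , P m

runOf : ∀ {n} → DPA n → SubsetN → SubsetN → SubsetN → ℕ → Fin n
runOf A P α β = run A (word P α β)

N+N≤1+m+m⇒N≤m : ∀ {N m} → N + N ≤ suc (m + m) → N ≤ m
N+N≤1+m+m⇒N≤m {N} {m} le = ≮⇒≥ λ m<N → 1+n≰n (begin
  suc (suc (m + m)) ≡⟨ cong suc (+-suc m m) ⟨
  suc m + suc m     ≤⟨ +-mono-≤ m<N m<N ⟩
  N + N             ≤⟨ le ⟩
  suc (m + m)       ∎)
  where open Data.Nat.Properties.≤-Reasoning

module Plays {n} (A : DPA n) (P : SubsetN) where
  open DPA A

  choice : SubsetN → SubsetN → Vtx A P → Bool
  choice α β (inj₁ (_ , m)) = α m
  choice α β (inj₂ (_ , _ , m)) = β m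

  play : SubsetN → SubsetN → ℕ → Vtx A P
  play α β zero = inj₁ (qinit , 0)
  play α β (suc i) = step A P (play α β i) (choice α β (play α β i))

  round : Vtx A P → ℕ
  round (inj₁ (_ , m)) = m
  round (inj₂ (_ , _ , m)) = m

  position : Vtx A P → ℕ
  position (inj₁ (_ , m)) = m + m
  position (inj₂ (_ , _ , m)) = suc (m + m)

  position≤ : ∀ v → position v ≤ suc (round v + round v)
  position≤ (inj₁ (_ , m)) = n≤1+n (m + m)
  position≤ (inj₂ _) = ≤-refl

  module _ (α β : SubsetN) where

    play-isPlay : IsPlay A P (play α β)
    play-isPlay = refl , λ i → _ , refl

    play-position : ∀ i → position (play α β i) ≡ i
    play-position zero = refl
    play-position (suc i) with play α β i | play-position i
    ... | inj₁ _ | eq = cong suc eq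
    ... | inj₂ (_ , _ , m) | eq = cong suc (trans (+-suc m m) eq)

    OnRun : Vtx A P → Set
    OnRun (inj₁ (q , m)) = q ≡ runOf A P α β m
    OnRun (inj₂ (q , a , m)) = q ≡ runOf A P α β m × a ≡ α m

    play-onRun : ∀ i → OnRun (play α β i)
    play-onRun zero = refl
    play-onRun (suc i) with play α β i | play-onRun i
    ... | inj₁ _ | q≡ = q≡ , refl
    ... | inj₂ (_ , _ , m) | q≡ , a≡ = cong₂ (λ q a → δ q (a , β m , P m)) q≡ a≡

    onRun-colour : ∀ v → OnRun v → colV A P v ≡ col (runOf A P α β (round v))
    onRun-colour (inj₁ _) q≡ = cong col q≡
    onRun-colour (inj₂ _) (q≡ , _) = cong col q≡

    play-even : ∀ m → play α β (m + m) ≡ inj₁ (runOf A P α β m , m)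
    play-even zero = refl
    play-even (suc m) rewrite +-suc m m | play-even m = refl

    play-odd : ∀ m → play α β (suc (m + m)) ≡ inj₂ (runOf A P α β m , α m , m)
    play-odd m = cong (λ v → step A P v (choice α β v)) (play-even m)

    recurrent-play⇔ : ∀ c → Recurrent (colV A P ∘ play α β) c ⇔ Recurrent (col ∘ runOf A P α β) c
    recurrent-play⇔ c = mk⇔ toRun fromRun
      where
      toRun : Recurrent (colV A P ∘ play α β) c → Recurrent (col ∘ runOf A P α β) c
      toRun rec N with rec (N + N)
      ... | i , le , colour≡c =
        let v = play α β i
            i≤ = subst (_≤ suc (round v + round v)) (play-position i) (position≤ v)
        in round v , N+N≤1+m+m⇒N≤m (≤-trans le i≤) ,
           trans (sym (onRun-colour v (play-onRun i))) colour≡c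
      fromRun : Recurrent (col ∘ runOf A P α β) c → Recurrent (colV A P ∘ play α β) c
      fromRun rec N with rec N
      ... | m , le , colour≡c = m + m , ≤-trans le (m≤m+n m m) ,
                                trans (cong (colV A P) (play-even m)) colour≡c

    winsI-play⇔ : WinsI A P (play α β) ⇔ MinRecurrentOdd (col ∘ runOf A P α β)
    winsI-play⇔ = minRecurrentOdd-cong recurrent-play⇔

    play-consistentI : (U : V₁ A P → Bool) → (∀ m → α m ≡ U (runOf A P α β m , m)) →
                       ConsistentI A P U (play α β)
    play-consistentI U follows i (q , m) eq = begin
      play α β (suc i)         ≡⟨ cong (λ v → step A P v (choice α β v)) eq ⟩
      inj₂ (q , α m , m)       ≡⟨ cong (λ a → inj₂ (q , a , m)) chosen ⟩
      inj₂ (q , U (q , m) , m) ∎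
      where
      open ≡-Reasoning
      q≡ : q ≡ runOf A P α β m
      q≡ = subst OnRun eq (play-onRun i)
      chosen : α m ≡ U (q , m)
      chosen = trans (follows m) (cong (λ p → U (p , m)) (sym q≡))

    play-consistentII : (U : V₂ A P → Bool) → (∀ m → β m ≡ U (runOf A P α β m , α m , m)) →
                        ConsistentII A P U (play α β)
    play-consistentII U follows i (q , a , m) eq = begin
      play α β (suc i)
        ≡⟨ cong (λ v → step A P v (choice α β v)) eq ⟩
      inj₁ (δ q (a , β m , P m) , suc m)
        ≡⟨ cong (λ b → inj₁ (δ q (a , b , P m) , suc m)) chosen ⟩
      inj₁ (δ q (a , U (q , a , m) , P m) , suc m) ∎
      where
      open ≡-Reasoning
      onRun : OnRun (inj₂ (q , a , m))
      onRun = subst OnRun eq (play-onRun i)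
      chosen : β m ≡ U (q , a , m)
      chosen = trans (follows m)
                     (cong₂ (λ q a → U (q , a , m)) (sym (proj₁ onRun)) (sym (proj₂ onRun)))

  evens odds : (ℕ → Bool) → SubsetN
  evens l m = l (m + m)
  odds l m = l (suc (m + m))

  choice-split : ∀ l v → l (position v) ≡ choice (evens l) (odds l) v
  choice-split l (inj₁ _) = refl
  choice-split l (inj₂ _) = refl

  play-of-labels : ∀ (π : ℕ → Vtx A P) l → π 0 ≡ inj₁ (qinit , 0) →
                   (∀ i → π (suc i) ≡ step A P (π i) (l i)) → ∀ i → π i ≡ play (evens l) (odds l) i
  play-of-labels π l π₀ πₛ zero = π₀
  play-of-labels π l π₀ πₛ (suc i) = begin
    π (suc i)                   ≡⟨ πₛ i ⟩
    step A P (π i) (l i)        ≡⟨ cong₂ (step A P) π≡ (cong l (sym (play-position α β i))) ⟩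
    step A P v (l (position v)) ≡⟨ cong (step A P v) (choice-split l v) ⟩
    play α β (suc i)            ∎
    where
    open ≡-Reasoning
    α β : SubsetN
    α = evens l
    β = odds l
    π≡ : π i ≡ play α β i
    π≡ = play-of-labels π l π₀ πₛ i
    v : Vtx A P
    v = play α β i

  label : ∀ {π} → IsPlay A P π → ℕ → Bool
  label pl i = proj₁ (proj₂ pl i)

  winsI-≗ : ∀ {π π'} → π ≗ π' → WinsI A P π → WinsI A P π'
  winsI-≗ e = to (minRecurrentOdd-cong (recurrent-≗ (cong (colV A P) ∘ e)))

  consistent-playI : ∀ U π → IsPlay A P π → ConsistentI A P U π →
    ∃ λ α → ∃ λ β → (∀ m → α m ≡ U (runOf A P α β m , m)) × π ≗ play α β
  consistent-playI U π pl consistent = evens l , odds l , follows , π≗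
    where
    l : ℕ → Bool
    l i = [ U , const (label pl i) ] (π i)
    πₛ : ∀ i → π (suc i) ≡ step A P (π i) (l i)
    πₛ i with π i in eq
    ... | inj₁ v = consistent i v eq
    ... | inj₂ v = trans (proj₂ (proj₂ pl i)) (cong (λ w → step A P w (label pl i)) eq)
    π≗ : π ≗ play (evens l) (odds l)
    π≗ = play-of-labels π l (proj₁ pl) πₛ
    follows : ∀ m → evens l m ≡ U (runOf A P (evens l) (odds l) m , m)
    follows m = cong [ U , const (label pl (m + m)) ] (trans (π≗ (m + m)) (play-even _ _ m))

  consistent-playII : ∀ U π → IsPlay A P π → ConsistentII A P U π →
    ∃ λ α → ∃ λ β → (∀ m → β m ≡ U (runOf A P α β m , α m , m)) × π ≗ play α β
  consistent-playII U π pl consistent = evens l , odds l , follows , π≗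
    where
    l : ℕ → Bool
    l i = [ const (label pl i) , U ] (π i)
    πₛ : ∀ i → π (suc i) ≡ step A P (π i) (l i)
    πₛ i with π i in eq
    ... | inj₁ v = trans (proj₂ (proj₂ pl i)) (cong (λ w → step A P w (label pl i)) eq)
    ... | inj₂ v = consistent i v eq
    π≗ : π ≗ play (evens l) (odds l)
    π≗ = play-of-labels π l (proj₁ pl) πₛ
    follows : ∀ m → odds l m ≡ U (runOf A P (evens l) (odds l) m , evens l m , m)
    follows m = cong [ const (label pl (suc (m + m))) , U ]
                     (trans (π≗ (suc (m + m))) (play-odd _ _ m))

  winningI⇔ : (U : V₁ A P → Bool) → WinningStratI A P U ⇔
    (∀ α β → (∀ m → α m ≡ U (runOf A P α β m , m)) → MinRecurrentOdd (col ∘ runOf A P α β))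
  winningI⇔ U = mk⇔
    (λ winning α β follows →
      to (winsI-play⇔ α β) (winning _ (play-isPlay α β) (play-consistentI α β U follows)))
    (λ winning π pl consistent →
      let α , β , follows , π≗ = consistent-playI U π pl consistent
      in winsI-≗ (sym ∘ π≗) (from (winsI-play⇔ α β) (winning α β follows)))

  winningII⇔ : (U : V₂ A P → Bool) → WinningStratII A P U ⇔
    (∀ α β → (∀ m → β m ≡ U (runOf A P α β m , α m , m)) → ¬ MinRecurrentOdd (col ∘ runOf A P α β))
  winningII⇔ U = mk⇔
    (λ winning α β follows →
      winning _ (play-isPlay α β) (play-consistentII α β U follows) ∘ from (winsI-play⇔ α β))
    (λ winning π pl consistent →
      let α , β , follows , π≗ = consistent-playII U π pl consistent
      in winning α β follows ∘ to (winsI-play⇔ α β) ∘ winsI-≗ π≗)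

-- iS q, iα, iβ, iP are the positions of S_q, α, β and P among the set variables.
module Formulas {n} (A : DPA n) {k} (iS : Fin n → Fin k) (iα iβ iP : Fin k) where
  open DPA A

  states : Vector SubsetN k → Fin n → SubsetN
  states σ q = σ (iS q)

  input : Vector SubsetN k → ℕ → Letter
  input σ m = σ iα m , σ iβ m , σ iP m

  Initᶠ : Formula 0 k
  Initᶠ = ∀¹ (∀¹ (¬ᶠ (zero <ᶠ suc zero)) ⇒ᶠ (zero ∈ᶠ iS qinit))

  Initᶠ-sem : ∀ {σ} → σ ⊨ Initᶠ ⇔ (states σ qinit 0 ≡ true)
  Initᶠ-sem = mk⇔ (λ h → h 0 (λ _ ()))
                  (λ s → λ { zero _ → s ; (suc a) minimal → ⊥-elim (minimal 0 (s≤s z≤n)) })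

  Succᶠ : Formula 2 k
  Succᶠ = (suc zero <ᶠ zero) ∧ᶠ ∀¹ (¬ᶠ ((suc (suc zero) <ᶠ zero) ∧ᶠ (zero <ᶠ suc zero)))

  Succᶠ-sem : ∀ {ρ σ} → Sat Succᶠ ρ σ ⇔ (ρ zero ≡ suc (ρ (suc zero)))
  Succᶠ-sem {ρ} {σ} = mk⇔ toSucc fromSucc
    where
    toSucc : Sat Succᶠ ρ σ → ρ zero ≡ suc (ρ (suc zero))
    toSucc (lt , nothingBetween) with m≤n⇒m<n∨m≡n lt
    ... | inj₁ 2+x≤y = ⊥-elim (nothingBetween _ (≤-refl , 2+x≤y))
    ... | inj₂ 1+x≡y = sym 1+x≡y
    fromSucc : ρ zero ≡ suc (ρ (suc zero)) → Sat Succᶠ ρ σ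
    fromSucc eq rewrite eq = ≤-refl , λ z (x<z , z<1+x) → <⇒≱ x<z (≤-pred z<1+x)

  letterᶠ : ∀ {m} → Fin m → Letter → Formula m k
  letterᶠ x (a , b , c) = litᶠ x iα a ∧ᶠ (litᶠ x iβ b ∧ᶠ litᶠ x iP c)

  letterᶠ-sem : ∀ {m} (x : Fin m) l {ρ σ} → Sat (letterᶠ x l) ρ σ ⇔ (l ≡ input σ (ρ x))
  letterᶠ-sem x (a , b , c) = ⇔.trans (litᶠ-sem x iα a ×-⇔ (litᶠ-sem x iβ b ×-⇔ litᶠ-sem x iP c))
    (mk⇔ (λ { (refl , refl , refl) → refl }) (λ { refl → refl , refl , refl }))

  transitionᶠ : Fin n → Letter → Formula 2 k
  transitionᶠ q l = letterᶠ (suc zero) l ⇒ᶠ (zero ∈ᶠ iS (δ q l))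

  successorᶠ : Fin n → Formula 2 k
  successorᶠ q = (suc zero ∈ᶠ iS q) ⇒ᶠ ⋀ᴸ (transitionᶠ q)

  successorᶠ-sem : ∀ q {ρ σ} → Sat (successorᶠ q) ρ σ ⇔
    (states σ q (ρ (suc zero)) ≡ true → states σ (δ q (input σ (ρ (suc zero)))) (ρ zero) ≡ true)
  successorᶠ-sem q {ρ} {σ} = →-cong-⇔ ⇔.refl (⇔.trans (⋀ᴸ-sem (transitionᶠ q) {ρ} {σ})
    (⇔.trans (∀-cong-⇔ λ l → →-cong-⇔ (letterᶠ-sem (suc zero) l {ρ} {σ}) ⇔.refl)
             (∀-≡-⇔ {B = λ l → states σ (δ q l) (ρ zero) ≡ true})))

  Stepᶠ : Formula 0 k
  Stepᶠ = ∀¹ (∀¹ (Succᶠ ⇒ᶠ ⋀ successorᶠ))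

  Stepᶠ-sem : ∀ {σ} → σ ⊨ Stepᶠ ⇔
              (∀ m q → states σ q m ≡ true → states σ (δ q (input σ m)) (suc m) ≡ true)
  Stepᶠ-sem {σ} = ∀-cong-⇔ λ x → ⇔.trans
    (∀-cong-⇔ λ y → →-cong-⇔ (Succᶠ-sem {y ∷ x ∷ []} {σ})
      (⇔.trans (⋀-sem successorᶠ) (∀-cong-⇔ λ q → successorᶠ-sem q {y ∷ x ∷ []} {σ})))
    ∀-≡-⇔

  Functionalᶠ : Formula 0 k
  Functionalᶠ = ∀¹ (⋀ λ q → ⋀ λ q' → ((zero ∈ᶠ iS q) ∧ᶠ (zero ∈ᶠ iS q')) ⇒ᶠ decᶠ (q ≟ q'))

  Functionalᶠ-sem : ∀ {σ} → σ ⊨ Functionalᶠ ⇔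
                    (∀ m q q' → states σ q m ≡ true × states σ q' m ≡ true → q ≡ q')
  Functionalᶠ-sem = ∀-cong-⇔ λ m → ⇔.trans (⋀-sem _) (∀-cong-⇔ λ q →
    ⇔.trans (⋀-sem _) (∀-cong-⇔ λ q' → →-cong-⇔ ⇔.refl (decᶠ-sem (q ≟ q'))))

  RunGraphᶠ : Formula 0 k
  RunGraphᶠ = Initᶠ ∧ᶠ (Stepᶠ ∧ᶠ Functionalᶠ)

  RunGraphᶠ-sem : ∀ {σ} → σ ⊨ RunGraphᶠ ⇔ Graph (run A (input σ)) (states σ)
  RunGraphᶠ-sem {σ} = ⇔.trans (Initᶠ-sem {σ} ×-⇔ (Stepᶠ-sem {σ} ×-⇔ Functionalᶠ-sem {σ}))
                              (⇔.sym (Graph-run⇔ A (input σ) (states σ)))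

  Recurrentᶠ : ℕ → Formula 0 k
  Recurrentᶠ c = ∀¹ (∃¹ ((¬ᶠ (zero <ᶠ suc zero)) ∧ᶠ ⋁ λ q → decᶠ (col q ≟ℕ c) ∧ᶠ (zero ∈ᶠ iS q)))

  Winᶠ : Formula 0 k
  Winᶠ = ⋁ λ q → decᶠ (col q % 2 ≟ℕ 1) ∧ᶠ (Recurrentᶠ (col q) ∧ᶠ
           ⋀ λ q' → decᶠ (col q' <? col q) ⇒ᶠ (¬ᶠ Recurrentᶠ (col q')))

  agreesᶠ : Fin k → (Fin n → Bool → Fin k) → Fin n → Bool → Formula 1 k
  agreesᶠ iX iU q a = litᶠ zero iα a ⇒ᶠ ((zero ∈ᶠ iX) ⇔ᶠ (zero ∈ᶠ iU q a))

  Followsᶠ : Fin k → (Fin n → Bool → Fin k) → Formula 0 k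
  Followsᶠ iX iU = ∀¹ (⋀ λ q → (zero ∈ᶠ iS q) ⇒ᶠ ⋀ᴮ (agreesᶠ iX iU q))

  module _ {σ : Vector SubsetN k} {r : ℕ → Fin n} (g : Graph r (states σ)) where

    Followsᶠ-sem : ∀ iX iU → σ ⊨ Followsᶠ iX iU ⇔ (∀ m → σ iX m ≡ σ (iU (r m) (σ iα m)) m)
    Followsᶠ-sem iX iU = ∀-cong-⇔ λ m → ⇔.trans (⋀-sem _) (⇔.trans
      (∀-cong-⇔ λ q → →-cong-⇔ ⇔.refl (⇔.trans (⋀ᴮ-sem (agreesᶠ iX iU q) {m ∷ []} {σ})
        (⇔.trans (∀-cong-⇔ λ a → →-cong-⇔ (litᶠ-sem zero iα a)
                                            (∈ᶠ-⇔ᶠ-sem zero iX (iU q a) {m ∷ []} {σ}))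
                 (∀-≡-⇔ {B = λ a → σ iX m ≡ σ (iU q a) m}))))
      (∀-graph-⇔ g m))

    Recurrentᶠ-sem : ∀ c → σ ⊨ Recurrentᶠ c ⇔ Recurrent (col ∘ r) c
    Recurrentᶠ-sem c = ∀-cong-⇔ λ N → ∃-cong-⇔ λ m → mk⇔ ≮⇒≥ ≤⇒≯ ×-⇔ ⇔.trans (⋁-sem _)
      (⇔.trans (∃-cong-⇔ λ q → decᶠ-sem (col q ≟ℕ c) ×-⇔ ⇔.refl) (∃-graph-⇔ g m))

    Winᶠ-sem : σ ⊨ Winᶠ ⇔ MinRecurrentOdd (col ∘ r)
    Winᶠ-sem = ⇔.trans (⋁-sem _) (⇔.trans
      (∃-cong-⇔ λ q → decᶠ-sem _ ×-⇔ (Recurrentᶠ-sem (col q) ×-⇔ ⇔.trans (⋀-sem _)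
        (∀-cong-⇔ λ q' → →-cong-⇔ (decᶠ-sem _) (¬-cong-⇔ (Recurrentᶠ-sem (col q'))))))
      (⇔.sym (minRecurrentOdd⇔ col r)))

-- The bound variables are, innermost first, β, α and the run sets S_q; iP and the strategy
-- sets iU q a index the k free variables.
module Strategies {n} (A : DPA n) {k} (iP : Fin k) (iU : Fin n → Bool → Fin k) where
  open DPA A

  free : Fin k → Fin (suc (suc (n + k)))
  free j = suc (suc (n ↑ʳ j))

  open Formulas A (λ q → suc (suc (q ↑ˡ k))) (suc zero) zero (free iP)

  ForAllRunsᶠ : Formula 0 (suc (suc (n + k))) → Formula 0 k
  ForAllRunsᶠ φ = ∀²ⁿ n (∀² (∀² (RunGraphᶠ ⇒ᶠ φ)))

  WinStIᶠ WinStIIᶠ : Formula 0 k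
  WinStIᶠ = ForAllRunsᶠ (Followsᶠ (suc zero) (λ q a → free (iU q a)) ⇒ᶠ Winᶠ)
  WinStIIᶠ = ForAllRunsᶠ (Followsᶠ zero (λ q a → free (iU q a)) ⇒ᶠ (¬ᶠ Winᶠ))

  module _ (σ : Vector SubsetN k) (P : SubsetN) (σ-P : σ iP ≡ P)
           (U : Fin n → Bool → SubsetN) (σ-U : ∀ q a → σ (iU q a) ≡ U q a) where

    env : (Fin n → SubsetN) → SubsetN → SubsetN → Vector SubsetN (suc (suc (n + k)))
    env T α β = β ∷ α ∷ prepend n T σ

    input-env : ∀ T α β → input (env T α β) ≗ word P α β
    input-env T α β m = cong (λ p → α m , β m , p) (cong-app (trans (prepend-↑ʳ n T σ iP) σ-P) m)

    ForAllRunsᶠ-sem : ∀ φ (Φ : SubsetN → SubsetN → Set) →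
      (∀ T α β → Graph (runOf A P α β) (states (env T α β)) → env T α β ⊨ φ ⇔ Φ α β) →
      σ ⊨ ForAllRunsᶠ φ ⇔ (∀ α β → Φ α β)
    ForAllRunsᶠ-sem φ Φ φ-sem = ⇔.trans (∀²ⁿ-sem n _) (mk⇔
      (λ h α β →
        let T = graph (runOf A P α β)
            g = Graph-graph (runOf A P α β) λ q m → cong-app (prepend-↑ˡ n T σ q) m
        in to (φ-sem T α β g) (h T α β (from (⇔.trans RunGraphᶠ-sem (runs T α β)) g)))
      (λ h T α β isGraph →
        from (φ-sem T α β (to (⇔.trans RunGraphᶠ-sem (runs T α β)) isGraph)) (h α β)))
      where
      runs : ∀ T α β → Graph (run A (input (env T α β))) (states (env T α β))
                       ⇔ Graph (runOf A P α β) (states (env T α β))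
      runs T α β = Graph-cong _ (run-cong A (input-env T α β))

    follows-env : ∀ {T α β} iX → Graph (runOf A P α β) (states (env T α β)) →
      env T α β ⊨ Followsᶠ iX (λ q a → free (iU q a)) ⇔
      (∀ m → env T α β iX m ≡ U (runOf A P α β m) (α m) m)
    follows-env {T} {α} {β} iX g = ⇔.trans (Followsᶠ-sem g iX (λ q a → free (iU q a)))
      (∀-cong-⇔ λ m → mk⇔ (λ e → trans e (strategy m)) (λ e → trans e (sym (strategy m))))
      where
      strategy : ∀ m → let q = runOf A P α β m in prepend n T σ (n ↑ʳ iU q (α m)) m ≡ U q (α m) m
      strategy m = cong-app (trans (prepend-↑ʳ n T σ _) (σ-U _ _)) m

    WinStIᶠ-sem : σ ⊨ WinStIᶠ ⇔
      (∀ α β → (∀ m → α m ≡ U (runOf A P α β m) (α m) m) → MinRecurrentOdd (col ∘ runOf A P α β))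
    WinStIᶠ-sem = ForAllRunsᶠ-sem _ _ λ T α β g → →-cong-⇔ (follows-env (suc zero) g) (Winᶠ-sem g)

    WinStIIᶠ-sem : σ ⊨ WinStIIᶠ ⇔
      (∀ α β → (∀ m → β m ≡ U (runOf A P α β m) (α m) m) → ¬ MinRecurrentOdd (col ∘ runOf A P α β))
    WinStIIᶠ-sem = ForAllRunsᶠ-sem _ _ λ T α β g →
      →-cong-⇔ (follows-env zero g) (¬-cong-⇔ (Winᶠ-sem g))

WinStI : ∀ {n} → DPA n → Formula 0 (n + 1)
WinStI {n} A = Strategies.WinStIᶠ A (n ↑ʳ zero) (λ q _ → q ↑ˡ 1)

strategyIndexII : ∀ n → Fin n → Bool → Fin ((n + n) + 1)
strategyIndexII n q false = (q ↑ˡ n) ↑ˡ 1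
strategyIndexII n q true = (n ↑ʳ q) ↑ˡ 1

WinStII : ∀ {n} → DPA n → Formula 0 ((n + n) + 1)
WinStII {n} A = Strategies.WinStIIᶠ A ((n + n) ↑ʳ zero) (strategyIndexII n)

module _ {n} (A : DPA n) (P : SubsetN) where

  WinStI-sem : ∀ W → (W ++ const P) ⊨ WinStI A ⇔ WinningStratI A P (UI W)
  WinStI-sem W = ⇔.trans
    (Strategies.WinStIᶠ-sem A _ _ (W ++ const P) P (lookup-++ʳ W (const P) zero)
                            (λ q _ → W q) (λ q _ → lookup-++ˡ W (const P) q))
    (⇔.sym (Plays.winningI⇔ A P (UI W)))

  WinStII-sem : ∀ W W' → ((W ++ W') ++ const P) ⊨ WinStII A ⇔ WinningStratII A P (UII W W')
  WinStII-sem W W' = ⇔.trans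
    (Strategies.WinStIIᶠ-sem A _ _ ((W ++ W') ++ const P) P (lookup-++ʳ (W ++ W') (const P) zero)
                             (λ q a m → UII W W' (q , a , m)) strategy)
    (⇔.sym (Plays.winningII⇔ A P (UII W W')))
    where
    strategy : ∀ q a → ((W ++ W') ++ const P) (strategyIndexII n q a) ≡ λ m → UII W W' (q , a , m)
    strategy q false = trans (lookup-++ˡ (W ++ W') (const P) (q ↑ˡ n)) (lookup-++ˡ W W' q)
    strategy q true = trans (lookup-++ˡ (W ++ W') (const P) (n ↑ʳ q)) (lookup-++ʳ W W' q)

lemma6p7 : Σ (∀ {n} → DPA n → Formula 0 (n + 1)) λ WinStI →
           Σ (∀ {n} → DPA n → Formula 0 ((n + n) + 1)) λ WinStII →
           ∀ {n} (A : DPA n) →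
             ((P : SubsetN) (W : Fin n → SubsetN) →
                ((W ++ (λ _ → P)) ⊨ WinStI A) ⇔ WinningStratI A P (UI W))
             × ((P : SubsetN) (W W' : Fin n → SubsetN) →
                (((W ++ W') ++ (λ _ → P)) ⊨ WinStII A) ⇔ WinningStratII A P (UII W W'))
lemma6p7 = WinStI , WinStII , λ A → WinStI-sem A , WinStII-sem A
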